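{- Fix a positive integer $k$ and a finite family of graphs $\mathcal{H}$. Among the complete edge weighted graphs $(R,w)$ on $k$ vertices, where $w:E(R)\rightarrow \{0,\frac{1}{2},1\}$ and $(R,w)$ has no $(H,0)$-admissible subgraph for any $H\in \mathcal{H}$, there is one with minimum weight $w(R)$ satisfying the following properties: the vertex set of $R$ can be partitioned into parts $X_{1},\dots,X_{s}$ such that for each $i\in [s]$ every edge inside $X_{i}$ has weight $1$, and for every $1\leq i<j\leq s$, either every edge between $X_{i}$ and $X_{j}$ has weight $\frac{1}{2}$, or every edge between $X_{i}$ and $X_{j}$ has weight $0$.
   Context: The weight of $(R,w)$ is $w(R)=\sum_{f\in E(R)}w(f)$. For a graph $H$, an $(H,0)$-admissible subgraph of the complete edge-weighted graph $(R,w)$ is a set $S$ of $|V(H)|$ vertices of $R$ together with a bijection $b:V(H)\to S$ and a total ordering $\prec$ of $V(H)$ such that (i) no edge inside $S$ has weight $1$, and (ii) whenever $xy\in E(H)$, $x\prec y$ and $w(b(x)b(y))=0$, then $w(b(x)b(z))+w(b(y)b(z))<1$ for every $z\in V(H)\setminus\{x,y\}$ with $x\prec z$. -}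

module Defs where

open import Data.Nat using (ℕ; zero; suc; _+_; _<_; _<ᵇ_)
open import Data.Bool using (Bool; true; false; if_then_else_)
open import Data.Fin using (Fin; toℕ)
import Data.Fin as F
open import Data.List using (List; map; allFin)
open import Data.Nat.ListAction using (sum)
open import Data.List.Membership.Propositional using (_∈_)
open import Data.Product using (Σ; _×_; ∃)
open import Relation.Binary.PropositionalEquality using (_≡_; _≢_)
open import Relation.Binary.Structures using (IsStrictTotalOrder)
open import Relation.Nullary using (¬_)
open import Function.Definitions using (Injective; Surjective)
open import Level using (Level; 0ℓ) renaming (suc to lsuc)

data W : Set where
  w0 w½ w1 : W

-- Twice the weight, as a natural number (0 ↦ 0, 1/2 ↦ 1, 1 ↦ 2).
dbl : W → ℕ
dbl w0 = 0
dbl w½ = 1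
dbl w1 = 2

record Graph : Set where
  field
    n      : ℕ
    adj    : Fin n → Fin n → Bool
    sym    : ∀ x y → adj x y ≡ adj y x
    irrefl : ∀ x → adj x x ≡ false
open Graph public

-- A weight function of the complete graph R on vertex set Fin k:
-- w u v is the weight of edge uv (u ≢ v); diagonal values are never used.
Weighting : ℕ → Set
Weighting k = Fin k → Fin k → W

IsSymmetric : ∀ {k} → Weighting k → Set
IsSymmetric w = ∀ u v → w u v ≡ w v u

-- Twice the total weight w(R) = Σ_{edges uv} w(uv)  (each unordered pair counted once, via v < u).
weight2 : ∀ {k} → Weighting k → ℕ
weight2 {k} w = sum (map (λ u → sum (map (λ v → if toℕ v <ᵇ toℕ u then dbl (w u v) else 0) (allFin k))) (allFin k))

-- (H,0)-admissible subgraph: injective b : V(H) → V(R) (a bijection onto its image S of size |V(H)|)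
-- and a strict total order ≺ on V(H) satisfying (i) and (ii).
Admissible : ∀ {k} → Graph → Weighting k → Set₁
Admissible {k} H w =
  Σ (Fin (n H) → Fin k) λ b → Injective _≡_ _≡_ b ×
  Σ (Fin (n H) → Fin (n H) → Set) λ _≺_ → IsStrictTotalOrder _≡_ _≺_ ×
    (∀ x y → x ≢ y → w (b x) (b y) ≢ w1) ×
    (∀ x y → adj H x y ≡ true → x ≺ y → w (b x) (b y) ≡ w0 →
       ∀ z → z ≢ x → z ≢ y → x ≺ z → dbl (w (b x) (b z)) + dbl (w (b y) (b z)) < 2)

Free : ∀ {k} → List Graph → Weighting k → Set₁
Free ℋ w = ∀ H → H ∈ ℋ → ¬ Admissible H w

-- The vertex set Fin k is partitioned into parts X_1..X_s (part u = index of the part containing u;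
-- surjectivity = parts nonempty) with weight 1 inside parts and, between two distinct parts,
-- all weights 1/2 or all weights 0.
Structured : ∀ {k} → Weighting k → Set
Structured {k} w =
  Σ ℕ λ s → Σ (Fin k → Fin s) λ part → Surjective _≡_ _≡_ part ×
    (∀ u v → u ≢ v → part u ≡ part v → w u v ≡ w1) ×
    (∀ (i j : Fin s) → i F.< j →
       (∀ u v → part u ≡ i → part v ≡ j → w u v ≡ w½) Data.Sum.⊎
       (∀ u v → part u ≡ i → part v ≡ j → w u v ≡ w0))
  where import Data.Sum

-- Freeness is decidable and there are finitely many weightings, so a free symmetric
-- weighting w of minimum weight exists. If w u v = 1, let w′ make u a copy of v (keeping weight 1
-- between them): an admissible subgraph of w′ maps injectively into w, so w′ is free, and the
-- copies of u onto v and of v onto u weigh 2 w(R) together, so by minimality w′ is again minimum.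
-- Copying each vertex in turn onto an earlier weight-1 neighbour, if any, makes all weight-1
-- pairs twins (equal weights to all other vertices). Then "equal or joined by weight 1" is an
-- equivalence whose classes are the parts X_i, and all edges between two classes have the same
-- weight, which is not 1.
module Submission where

open import Defs hiding (sym; irrefl)

open import Data.Bool using (Bool; true; false; if_then_else_; T)
import Data.Bool as Bool
open import Data.Empty using (⊥-elim)
open import Data.Fin using (Fin; toℕ; fromℕ<; _≟_) renaming (_<_ to _<ᶠ_)
import Data.Fin.Permutation as Permutation
open import Data.Fin.Permutation.Components using (transpose)
import Data.Fin.Properties as Finₚ
open import Data.List using (List; map; allFin; tabulate)
open import Data.List.Properties using (map-tabulate)
open import Data.List.Relation.Unary.All as All using (all?)
open import Data.Nat using (ℕ; zero; suc; _+_; _<_; _≤_; _<ᵇ_; _<?_; s≤s⁻¹)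
open import Data.Nat.ListAction using () renaming (sum to sumˡ)
open import Data.Nat.Properties
  using (+-0-commutativeMonoid; +-comm; +-identityʳ; +-mono-≤; +-mono-<; +-mono-<-≤;
         <-irrefl; <-asym; <-cmp; ≤-refl; ≤-trans; <-≤-trans; <⇒≤; ≮⇒≥; m≤n⇒m<n∨m≡n; module ≤-Reasoning)
open import Algebra.Properties.CommutativeMonoid.Sum +-0-commutativeMonoid
  using (sum; sum-syntax; sum-cong-≗; ∑-distrib-+; ∑-comm; ∑-permute)
open import Data.Product using (Σ; ∃; _×_; _,_)
open import Data.Sum as Sum using (_⊎_; inj₁; inj₂)
open import Data.Vec.Functional using (Vector; _∷_)
open import Data.Vec.Functional.Relation.Binary.Pointwise using (Pointwise)
open import Function using (_∘_; id)
open import Function.Definitions using (Injective; Surjective)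
open import Level using (Level) renaming (suc to lsuc)
import Relation.Binary.Construct.On as On
open import Relation.Binary.Definitions using (Trichotomous; tri<; tri≈; tri>)
open import Relation.Binary.PropositionalEquality
open import Relation.Binary.Structures using (IsStrictTotalOrder; IsDecEquivalence)
open import Relation.Nullary
open import Relation.Nullary.Decidable
  using (dec-true; dec-false; map′; isYes; toWitness; fromWitness; T?; ¬?; _×-dec_; _→-dec_; _⊎-dec_)
import Relation.Unary as U

∑∑-distrib-+ : ∀ {m n} (f g : Fin m → Fin n → ℕ) →
  ∑[ x < m ] ∑[ y < n ] (f x y + g x y) ≡ ∑[ x < m ] ∑[ y < n ] f x y + ∑[ x < m ] ∑[ y < n ] g x y
∑∑-distrib-+ {m} {n} f g =
  trans (sum-cong-≗ (λ x → ∑-distrib-+ (f x) (g x))) (∑-distrib-+ (λ x → ∑[ y < n ] f x y) (λ x → ∑[ y < n ] g x y))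

sum-map-allFin : ∀ {n} (f : Fin n → ℕ) → sumˡ (map f (allFin n)) ≡ ∑[ i < n ] f i
sum-map-allFin f = trans (cong sumˡ (map-tabulate id f)) (sum-tabulate f)
  where
  sum-tabulate : ∀ {n} (f : Fin n → ℕ) → sumˡ (tabulate f) ≡ sum f
  sum-tabulate {zero} f = refl
  sum-tabulate {suc n} f = cong (f Fin.zero +_) (sum-tabulate (f ∘ Fin.suc))

module _ {k : ℕ} (w : Weighting k) where

  lowerWeight2 : Fin k → Fin k → ℕ
  lowerWeight2 u v = if toℕ v <ᵇ toℕ u then dbl (w u v) else 0

  edgeWeight2 : Fin k → Fin k → ℕ
  edgeWeight2 u v = if does (u ≟ v) then 0 else dbl (w u v)

  orderedWeight2 : ℕ
  orderedWeight2 = ∑[ u < k ] ∑[ v < k ] edgeWeight2 u v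

  weight2≡∑∑lowerWeight2 : weight2 w ≡ ∑[ u < k ] ∑[ v < k ] lowerWeight2 u v
  weight2≡∑∑lowerWeight2 = trans (sum-map-allFin (λ u → sumˡ (map (lowerWeight2 u) (allFin k))))
                                 (sum-cong-≗ (λ u → sum-map-allFin (lowerWeight2 u)))

  edgeWeight2-diag : ∀ u → edgeWeight2 u u ≡ 0
  edgeWeight2-diag u rewrite dec-true (u ≟ u) refl = refl

  edgeWeight2-off : ∀ {u v} → u ≢ v → edgeWeight2 u v ≡ dbl (w u v)
  edgeWeight2-off {u} {v} u≢v rewrite dec-false (u ≟ v) u≢v = refl

  edgeWeight2-sym : IsSymmetric w → ∀ u v → edgeWeight2 u v ≡ edgeWeight2 v u
  edgeWeight2-sym sym-w u v = equal-or-apart (u ≟ v)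
    where
    equal-or-apart : Dec (u ≡ v) → edgeWeight2 u v ≡ edgeWeight2 v u
    equal-or-apart (yes refl) = refl
    equal-or-apart (no u≢v) =
      trans (edgeWeight2-off u≢v) (trans (cong dbl (sym-w u v)) (sym (edgeWeight2-off (≢-sym u≢v))))

  -- does (m <? n) reduces to m <ᵇ n, so dec-true/dec-false decide the guards of lowerWeight2.
  edgeWeight2-split : IsSymmetric w → ∀ u v → edgeWeight2 u v ≡ lowerWeight2 u v + lowerWeight2 v u
  edgeWeight2-split sym-w u v with u ≟ v
  ... | yes refl rewrite dec-false (toℕ u <? toℕ u) (<-irrefl refl) = refl
  ... | no u≢v with <-cmp (toℕ u) (toℕ v)
  ...   | tri< u<v _ _ rewrite dec-false (toℕ v <? toℕ u) (<-asym u<v) | dec-true (toℕ u <? toℕ v) u<v =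
          cong dbl (sym-w u v)
  ...   | tri≈ _ u≡v _ = ⊥-elim (u≢v (Finₚ.toℕ-injective u≡v))
  ...   | tri> _ _ v<u rewrite dec-true (toℕ v <? toℕ u) v<u | dec-false (toℕ u <? toℕ v) (<-asym v<u) =
          sym (+-identityʳ _)

  weight2-double : IsSymmetric w → weight2 w + weight2 w ≡ orderedWeight2
  weight2-double sym-w = begin
    weight2 w + weight2 w
      ≡⟨ cong₂ _+_ weight2≡∑∑lowerWeight2 (trans weight2≡∑∑lowerWeight2 (∑-comm lowerWeight2)) ⟩
    ∑[ u < k ] ∑[ v < k ] lowerWeight2 u v + ∑[ u < k ] ∑[ v < k ] lowerWeight2 v u
      ≡⟨ ∑∑-distrib-+ lowerWeight2 (λ u v → lowerWeight2 v u) ⟨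
    ∑[ u < k ] ∑[ v < k ] (lowerWeight2 u v + lowerWeight2 v u)
      ≡⟨ sum-cong-≗ (λ u → sum-cong-≗ (λ v → edgeWeight2-split sym-w u v)) ⟨
    orderedWeight2 ∎
    where open ≡-Reasoning

weight2-cong : ∀ {k} {w w′ : Weighting k} → (∀ u v → w u v ≡ w′ u v) → weight2 w ≡ weight2 w′
weight2-cong {w = w} {w′} w≗w′ = begin
  weight2 w
    ≡⟨ weight2≡∑∑lowerWeight2 w ⟩
  ∑[ u < _ ] ∑[ v < _ ] lowerWeight2 w u v
    ≡⟨ sum-cong-≗ (λ u → sum-cong-≗ (λ v → cong (λ c → if _ then dbl c else 0) (w≗w′ u v))) ⟩
  ∑[ u < _ ] ∑[ v < _ ] lowerWeight2 w′ u v
    ≡⟨ weight2≡∑∑lowerWeight2 w′ ⟨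
  weight2 w′ ∎
  where open ≡-Reasoning

Exhaustible : ∀ ℓ (A : Set) → (A → A → Set) → Set (lsuc ℓ)
Exhaustible ℓ A _≈_ = (P : A → Set ℓ) → (∀ {a b} → a ≈ b → P a → P b) → U.Decidable P → Dec (∃ P)

module _ {ℓ : Level} where

  Fin-exhaustible : ∀ {n} → Exhaustible ℓ (Fin n) _≡_
  Fin-exhaustible P _ P? = Finₚ.any? P?

  Bool-exhaustible : Exhaustible ℓ Bool _≡_
  Bool-exhaustible P _ P? with P? false | P? true
  ... | yes p | _     = yes (false , p)
  ... | no _  | yes p = yes (true , p)
  ... | no ¬p | no ¬q = no λ { (false , p) → ¬p p ; (true , p) → ¬q p }

  W-exhaustible : Exhaustible ℓ W _≡_
  W-exhaustible P _ P? with P? w0 | P? w½ | P? w1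
  ... | yes p | _     | _     = yes (w0 , p)
  ... | no _  | yes p | _     = yes (w½ , p)
  ... | no _  | no _  | yes p = yes (w1 , p)
  ... | no ¬p | no ¬q | no ¬r = no λ { (w0 , p) → ¬p p ; (w½ , p) → ¬q p ; (w1 , p) → ¬r p }

  -- Without function extensionality, a predicate on functions must be assumed to respect
  -- pointwise equality for the search to decompose a function into its head and tail.
  Vector-exhaustible : ∀ {A _≈_} → (∀ {a} → a ≈ a) → Exhaustible ℓ A _≈_ →
                       ∀ n → Exhaustible ℓ (Vector A n) (Pointwise _≈_)
  Vector-exhaustible ≈-refl _ zero P resp P? with P? (λ ())
  ... | yes p = yes ((λ ()) , p)
  ... | no ¬p = no λ (f , p) → ¬p (resp (λ ()) p)
  Vector-exhaustible {A} {_≈_} ≈-refl search (suc n) P resp P? with search HasTail respHead hasTail?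
    where
    HasTail : A → Set ℓ
    HasTail a = ∃ λ g → P (a ∷ g)
    respHead : ∀ {a b} → a ≈ b → HasTail a → HasTail b
    respHead a≈b (g , p) = g , resp (λ { Fin.zero → a≈b ; (Fin.suc i) → ≈-refl }) p
    hasTail? : U.Decidable HasTail
    hasTail? a = Vector-exhaustible ≈-refl search n (λ g → P (a ∷ g))
      (λ g≈g′ → resp (λ { Fin.zero → ≈-refl ; (Fin.suc i) → g≈g′ i })) (λ g → P? (a ∷ g))
  ... | yes (a , g , p) = yes (a ∷ g , p)
  ... | no ¬p = no λ (f , p) → ¬p (f Fin.zero , f ∘ Fin.suc , resp (λ { Fin.zero → ≈-refl ; (Fin.suc i) → ≈-refl }) p)

_≟ᵂ_ : (a b : W) → Dec (a ≡ b)
w0 ≟ᵂ w0 = yes refl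
w0 ≟ᵂ w½ = no λ ()
w0 ≟ᵂ w1 = no λ ()
w½ ≟ᵂ w0 = no λ ()
w½ ≟ᵂ w½ = yes refl
w½ ≟ᵂ w1 = no λ ()
w1 ≟ᵂ w0 = no λ ()
w1 ≟ᵂ w½ = no λ ()
w1 ≟ᵂ w1 = yes refl

adj⇒≢ : ∀ (H : Graph) {x y} → adj H x y ≡ true → x ≢ y
adj⇒≢ H {x} xy refl with trans (sym xy) (Graph.irrefl H x)
... | ()

module _ (H : Graph) where

  AdmissibleConditions : Weighting (n H) → (Fin (n H) → Fin (n H) → Set) → Set
  AdmissibleConditions v _≺_ =
    (∀ x y → x ≢ y → v x y ≢ w1) ×
    (∀ x y → adj H x y ≡ true → x ≺ y → v x y ≡ w0 →
       ∀ z → z ≢ x → z ≢ y → x ≺ z → dbl (v x z) + dbl (v y z) < 2)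

  AdmissibleConditions? : ∀ v {_≺_} → (∀ x y → Dec (x ≺ y)) → Dec (AdmissibleConditions v _≺_)
  AdmissibleConditions? v _≺?_ =
    Finₚ.all? (λ x → Finₚ.all? λ y → ¬? (x ≟ y) →-dec ¬? (v x y ≟ᵂ w1)) ×-dec
    Finₚ.all? (λ x → Finₚ.all? λ y → (adj H x y Bool.≟ true) →-dec (x ≺? y) →-dec (v x y ≟ᵂ w0) →-dec
      Finₚ.all? λ z → ¬? (z ≟ x) →-dec ¬? (z ≟ y) →-dec (x ≺? z) →-dec (dbl (v x z) + dbl (v y z) <? 2))

  -- The conditions only involve weights of distinct pairs and use ≺ only in hypotheses.
  AdmissibleConditions-mono : ∀ {v v′ _≺_ _≺′_} → (∀ x y → x ≢ y → v x y ≡ v′ x y) →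
    (∀ {x y} → x ≺′ y → x ≺ y) → AdmissibleConditions v _≺_ → AdmissibleConditions v′ _≺′_
  AdmissibleConditions-mono {v} {v′} v≡v′ ≺′⇒≺ (no-w1 , ii) =
    (λ x y x≢y v′≡w1 → no-w1 x y x≢y (trans (v≡v′ x y x≢y) v′≡w1)) ,
    (λ x y xy x≺y v′≡w0 z z≢x z≢y x≺z →
      subst₂ (λ a b → dbl a + dbl b < 2) (v≡v′ x z (≢-sym z≢x)) (v≡v′ y z (≢-sym z≢y))
        (ii x y xy (≺′⇒≺ x≺y) (trans (v≡v′ x y (adj⇒≢ H xy)) v′≡w0) z z≢x z≢y (≺′⇒≺ x≺z)))

module _ {m : ℕ} where

  IsStrictTotalᵇ : (Fin m → Fin m → Bool) → Set
  IsStrictTotalᵇ R = (∀ x → ¬ T (R x x)) × (∀ x y z → T (R x y) → T (R y z) → T (R x z)) ×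
                     (∀ x y → x ≢ y → T (R x y) ⊎ T (R y x))

  IsStrictTotalᵇ? : ∀ R → Dec (IsStrictTotalᵇ R)
  IsStrictTotalᵇ? R =
    Finₚ.all? (λ x → ¬? (T? (R x x))) ×-dec
    Finₚ.all? (λ x → Finₚ.all? λ y → Finₚ.all? λ z → T? (R x y) →-dec T? (R y z) →-dec T? (R x z)) ×-dec
    Finₚ.all? (λ x → Finₚ.all? λ y → ¬? (x ≟ y) →-dec (T? (R x y) ⊎-dec T? (R y x)))

  IsStrictTotalᵇ-cong : ∀ {R R′} → (∀ x y → R x y ≡ R′ x y) → IsStrictTotalᵇ R → IsStrictTotalᵇ R′
  IsStrictTotalᵇ-cong {R} {R′} R≡R′ (irr , tr , connex) =
    (λ x → irr x ∘ from x x) ,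
    (λ x y z p q → to x z (tr x y z (from x y p) (from y z q))) ,
    (λ x y x≢y → Sum.map (to x y) (to y x) (connex x y x≢y))
    where
    to : ∀ x y → T (R x y) → T (R′ x y)
    to x y = subst T (R≡R′ x y)
    from : ∀ x y → T (R′ x y) → T (R x y)
    from x y = subst T (sym (R≡R′ x y))

  isStrictTotalOrder-T : ∀ {R} → IsStrictTotalᵇ R → IsStrictTotalOrder _≡_ (λ x y → T (R x y))
  isStrictTotalOrder-T {R} (irr , tr , connex) = record
    { isStrictPartialOrder = record
      { isEquivalence = isEquivalence
      ; irrefl = λ { {x} refl → irr x }
      ; trans = λ {x} {y} {z} → tr x y z
      ; <-resp-≈ = (λ { refl p → p }) , (λ { refl p → p }) }
    ; compare = compare }
    where
    compare : Trichotomous _≡_ (λ x y → T (R x y))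
    compare x y with x ≟ y
    ... | yes refl = tri≈ (irr x) refl (irr x)
    ... | no x≢y with connex x y x≢y
    ...   | inj₁ xy = tri< xy x≢y (λ yx → irr x (tr x y x xy yx))
    ...   | inj₂ yx = tri> (λ xy → irr x (tr x y x xy yx)) x≢y yx

  isStrictTotalᵇ : ∀ {_≺_ : Fin m → Fin m → Set} (sto : IsStrictTotalOrder _≡_ _≺_) →
                   IsStrictTotalᵇ (λ x y → isYes (IsStrictTotalOrder._<?_ sto x y))
  isStrictTotalᵇ sto =
    (λ x p → ≺-irrefl refl (toWitness p)) ,
    (λ x y z p q → fromWitness (≺-trans (toWitness p) (toWitness q))) ,
    connex
    where
    open IsStrictTotalOrder sto using (compare) renaming (irrefl to ≺-irrefl; trans to ≺-trans)
    connex : ∀ x y → x ≢ y → _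
    connex x y x≢y with compare x y
    ... | tri< x≺y _ _ = inj₁ (fromWitness x≺y)
    ... | tri≈ _ x≡y _ = ⊥-elim (x≢y x≡y)
    ... | tri> _ _ y≺x = inj₂ (fromWitness y≺x)

Injective? : ∀ {m k} (b : Fin m → Fin k) → Dec (Injective _≡_ _≡_ b)
Injective? b = map′ (λ inj {x} {y} → inj x y) (λ inj x y → inj)
  (Finₚ.all? λ x → Finₚ.all? λ y → (b x ≟ b y) →-dec (x ≟ y))

module _ (H : Graph) {k : ℕ} (w : Weighting k) where

  -- An admissible subgraph with the order ≺ encoded as a Boolean relation, so that it ranges
  -- over a finite, exhaustively searchable type.
  AdmissibleVia : (Fin (n H) → Fin k) → Set
  AdmissibleVia b = Injective _≡_ _≡_ b × ∃ λ R → IsStrictTotalᵇ R ×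
    AdmissibleConditions H (λ x y → w (b x) (b y)) (λ x y → T (R x y))

  Admissible⇒∃AdmissibleVia : Admissible H w → ∃ AdmissibleVia
  Admissible⇒∃AdmissibleVia (b , inj , _ , sto , conditions) =
    b , inj , _ , isStrictTotalᵇ sto , AdmissibleConditions-mono H (λ _ _ _ → refl) toWitness conditions

  ∃AdmissibleVia⇒Admissible : ∃ AdmissibleVia → Admissible H w
  ∃AdmissibleVia⇒Admissible (b , inj , _ , strict , conditions) =
    b , inj , _ , isStrictTotalOrder-T strict , conditions

  AdmissibleVia-cong : ∀ {b b′} → (∀ x → b x ≡ b′ x) → AdmissibleVia b → AdmissibleVia b′
  AdmissibleVia-cong {b} {b′} b≡b′ (inj , R , strict , conditions) =
    (λ {x} {y} e → inj (trans (b≡b′ x) (trans e (sym (b≡b′ y))))) , R , strict ,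
    AdmissibleConditions-mono H (λ x y _ → cong₂ w (b≡b′ x) (b≡b′ y)) id conditions

  AdmissibleVia? : ∀ b → Dec (AdmissibleVia b)
  AdmissibleVia? b = Injective? b ×-dec
    Vector-exhaustible (λ _ → refl) (Vector-exhaustible refl Bool-exhaustible (n H)) (n H)
      (λ R → IsStrictTotalᵇ R × AdmissibleConditions H _ (λ x y → T (R x y)))
      (λ R≡R′ (strict , conditions) →
        IsStrictTotalᵇ-cong R≡R′ strict , AdmissibleConditions-mono H (λ _ _ _ → refl) (subst T (sym (R≡R′ _ _))) conditions)
      (λ R → IsStrictTotalᵇ? R ×-dec AdmissibleConditions? H _ (λ x y → T? (R x y)))

  Admissible? : Dec (Admissible H w)
  Admissible? = map′ ∃AdmissibleVia⇒Admissible Admissible⇒∃AdmissibleVia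
    (Vector-exhaustible refl Fin-exhaustible (n H) AdmissibleVia AdmissibleVia-cong AdmissibleVia?)

Free? : ∀ {k} (ℋ : List Graph) (w : Weighting k) → Dec (Free ℋ w)
Free? ℋ w = map′ (λ free H H∈ℋ → All.lookup free H∈ℋ) (λ free → All.tabulate (free _))
  (all? (λ H → ¬? (Admissible? H w)) ℋ)

module _ {k : ℕ} {w w′ : Weighting k} (w≡w′ : ∀ u v → w u v ≡ w′ u v) where

  IsSymmetric-cong : IsSymmetric w → IsSymmetric w′
  IsSymmetric-cong sym-w u v = trans (sym (w≡w′ u v)) (trans (sym-w u v) (w≡w′ v u))

  Admissible-cong : ∀ H → Admissible H w → Admissible H w′
  Admissible-cong H (b , inj , _≺_ , sto , conditions) =
    b , inj , _≺_ , sto , AdmissibleConditions-mono H (λ x y _ → w≡w′ (b x) (b y)) id conditions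

Free-cong : ∀ {k} {w w′ : Weighting k} ℋ → (∀ u v → w u v ≡ w′ u v) → Free ℋ w → Free ℋ w′
Free-cong ℋ w≡w′ free H H∈ℋ = free H H∈ℋ ∘ Admissible-cong (λ u v → sym (w≡w′ u v)) H

IsSymmetric? : ∀ {k} (w : Weighting k) → Dec (IsSymmetric w)
IsSymmetric? w = Finₚ.all? λ u → Finₚ.all? λ v → w u v ≟ᵂ w v u

module _ {a ℓ} {A : Set a} (P : A → Set ℓ) (μ : A → ℕ)
         (below? : ∀ m → Dec (∃ λ x → P x × μ x < m)) where

  minimiser : ∀ {x} → P x → ∃ λ y → P y × (∀ z → P z → μ y ≤ μ z)
  minimiser {x} Px = descend (suc (μ x)) x Px ≤-refl
    where
    descend : ∀ fuel x → P x → μ x < fuel → ∃ λ y → P y × (∀ z → P z → μ y ≤ μ z)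
    descend (suc fuel) x Px μx<fuel with below? (μ x)
    ... | yes (y , Py , μy<μx) = descend fuel y Py (<-≤-trans μy<μx (s≤s⁻¹ μx<fuel))
    ... | no ¬below = x , Px , λ z Pz → ≮⇒≥ (λ μz<μx → ¬below (z , Pz , μz<μx))

IsMinimum : ∀ {k} → List Graph → Weighting k → Set₁
IsMinimum {k} ℋ w = IsSymmetric w × Free ℋ w ×
  ((w′ : Weighting k) → IsSymmetric w′ → Free ℋ w′ → weight2 w ≤ weight2 w′)

Feasible : ∀ {k} → List Graph → Weighting k → Set₁
Feasible ℋ w = IsSymmetric w × Free ℋ w

feasible-below? : ∀ {k} (ℋ : List Graph) m → Dec (∃ λ (w : Weighting k) → Feasible ℋ w × weight2 w < m)
feasible-below? {k} ℋ m = Vector-exhaustible (λ _ → refl) (Vector-exhaustible refl W-exhaustible k) k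
  (λ w → Feasible ℋ w × weight2 w < m)
  (λ w≡w′ ((sym-w , free) , lt) →
    (IsSymmetric-cong w≡w′ sym-w , Free-cong ℋ w≡w′ free) , subst (_< m) (weight2-cong w≡w′) lt)
  (λ w → (IsSymmetric? w ×-dec Free? ℋ w) ×-dec (weight2 w <? m))

minimum-exists : ∀ {k} (ℋ : List Graph) {w₀ : Weighting k} → IsSymmetric w₀ → Free ℋ w₀ →
                 ∃ (IsMinimum ℋ)
minimum-exists ℋ sym₀ free₀ with minimiser (Feasible ℋ) weight2 (feasible-below? ℋ) (sym₀ , free₀)
... | w , (sym-w , free) , least = w , sym-w , free , λ w′ sym′ free′ → least w′ (sym′ , free′)

module _ {k : ℕ} (σ : Fin k → Fin k) (w : Weighting k) where

  -- Vertices identified by σ are joined by weight 1, so that σ stays injective on any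
  -- admissible subgraph.
  pullback : Weighting k
  pullback x y = if does (σ x ≟ σ y) then w1 else w (σ x) (σ y)

  pullback-apart : ∀ {x y x′ y′} → σ x ≡ x′ → σ y ≡ y′ → x′ ≢ y′ → pullback x y ≡ w x′ y′
  pullback-apart {x} {y} refl refl σx≢σy rewrite dec-false (σ x ≟ σ y) σx≢σy = refl

  pullback-merged : ∀ {x y} → σ x ≡ σ y → pullback x y ≡ w1
  pullback-merged {x} {y} σx≡σy rewrite dec-true (σ x ≟ σ y) σx≡σy = refl

  IsSymmetric-pullback : IsSymmetric w → IsSymmetric pullback
  IsSymmetric-pullback sym-w x y with σ x ≟ σ y
  ... | yes σx≡σy = sym (pullback-merged (sym σx≡σy))
  ... | no σx≢σy = trans (sym-w (σ x) (σ y)) (sym (pullback-apart refl refl (≢-sym σx≢σy)))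

  Admissible-pullback : ∀ H → Admissible H pullback → Admissible H w
  Admissible-pullback H (b , _ , _≺_ , sto , conditions@(no-w1 , _)) =
    σ ∘ b , inj , _≺_ , sto , AdmissibleConditions-mono H (λ x y x≢y → pullback-apart refl refl (x≢y ∘ inj)) id conditions
    where
    inj : Injective _≡_ _≡_ (σ ∘ b)
    inj {x} {y} σbx≡σby with x ≟ y
    ... | yes x≡y = x≡y
    ... | no x≢y = ⊥-elim (no-w1 x y x≢y (pullback-merged σbx≡σby))

  Free-pullback : ∀ ℋ → Free ℋ w → Free ℋ pullback
  Free-pullback ℋ free H H∈ℋ = free H H∈ℋ ∘ Admissible-pullback H

  edgeWeight2-pullback-apart : ∀ {x y x′ y′} → x ≢ y → σ x ≡ x′ → σ y ≡ y′ → x′ ≢ y′ →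
                               edgeWeight2 pullback x y ≡ edgeWeight2 w x′ y′
  edgeWeight2-pullback-apart x≢y σx≡x′ σy≡y′ x′≢y′ = trans (edgeWeight2-off pullback x≢y)
    (trans (cong dbl (pullback-apart σx≡x′ σy≡y′ x′≢y′)) (sym (edgeWeight2-off w x′≢y′)))

  edgeWeight2-pullback-merged : ∀ {x y} → x ≢ y → σ x ≡ σ y → edgeWeight2 pullback x y ≡ 2
  edgeWeight2-pullback-merged x≢y σx≡σy = trans (edgeWeight2-off pullback x≢y) (cong dbl (pullback-merged σx≡σy))

redirect : ∀ {k} → Fin k → Fin k → Fin k → Fin k
redirect u v x = if does (x ≟ u) then v else x

clone : ∀ {k} → Fin k → Fin k → Weighting k → Weighting k
clone u v = pullback (redirect u v)

data Position {k : ℕ} (u v : Fin k) : Fin k → Set where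
  at-u      : Position u v u
  at-v      : Position u v v
  elsewhere : ∀ {x} → x ≢ u → x ≢ v → Position u v x

position : ∀ {k} (u v x : Fin k) → Position u v x
position u v x with x ≟ u | x ≟ v
... | yes refl | _        = at-u
... | no _     | yes refl = at-v
... | no x≢u   | no x≢v   = elsewhere x≢u x≢v

module _ {k : ℕ} {u v : Fin k} (u≢v : u ≢ v) where

  redirect-u : redirect u v u ≡ v
  redirect-u rewrite dec-true (u ≟ u) refl = refl

  redirect-v : redirect u v v ≡ v
  redirect-v rewrite dec-false (v ≟ u) (≢-sym u≢v) = refl

  redirect-elsewhere : ∀ {x} → x ≢ u → redirect u v x ≡ x
  redirect-elsewhere {x} x≢u rewrite dec-false (x ≟ u) x≢u = refl

  transpose-u : transpose u v u ≡ v
  transpose-u rewrite dec-true (u ≟ u) refl = refl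

  transpose-v : transpose u v v ≡ u
  transpose-v rewrite dec-false (v ≟ u) (≢-sym u≢v) | dec-true (v ≟ v) refl = refl

  transpose-elsewhere : ∀ {x} → x ≢ u → x ≢ v → transpose u v x ≡ x
  transpose-elsewhere {x} x≢u x≢v rewrite dec-false (x ≟ u) x≢u | dec-false (x ≟ v) x≢v = refl

module _ {k : ℕ} {w : Weighting k} (sym-w : IsSymmetric w) {u v : Fin k} (u≢v : u ≢ v) (uv≡w1 : w u v ≡ w1) where

  private
    A B : Weighting k
    A = clone u v w
    B = clone v u w

    v≢u : v ≢ u
    v≢u = ≢-sym u≢v

    edgeWeight2-uv : edgeWeight2 w u v ≡ 2
    edgeWeight2-uv = trans (edgeWeight2-off w u≢v) (cong dbl uv≡w1)

    edgeWeight2-vu : edgeWeight2 w v u ≡ 2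
    edgeWeight2-vu = trans (edgeWeight2-off w v≢u) (cong dbl (trans (sym-w v u) uv≡w1))

    σ-apart = edgeWeight2-pullback-apart (redirect u v) w
    τ-apart = edgeWeight2-pullback-apart (redirect v u) w
    σ-merged = edgeWeight2-pullback-merged (redirect u v) w
    τ-merged = edgeWeight2-pullback-merged (redirect v u) w

    mirror : ∀ {x y} →
      edgeWeight2 A y x + edgeWeight2 B y x ≡ edgeWeight2 w y x + edgeWeight2 w (transpose u v y) (transpose u v x) →
      edgeWeight2 A x y + edgeWeight2 B x y ≡ edgeWeight2 w x y + edgeWeight2 w (transpose u v x) (transpose u v y)
    mirror {x} {y} e = trans
      (cong₂ _+_ (edgeWeight2-sym A (IsSymmetric-pullback _ w sym-w) x y) (edgeWeight2-sym B (IsSymmetric-pullback _ w sym-w) x y))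
      (trans e (cong₂ _+_ (edgeWeight2-sym w sym-w y x) (edgeWeight2-sym w sym-w _ _)))

  edgeWeight2-clones-apart : ∀ {x y} → x ≢ y → Position u v x → Position u v y →
    edgeWeight2 A x y + edgeWeight2 B x y ≡ edgeWeight2 w x y + edgeWeight2 w (transpose u v x) (transpose u v y)
  edgeWeight2-clones-apart x≢y at-u at-u = ⊥-elim (x≢y refl)
  edgeWeight2-clones-apart x≢y at-v at-v = ⊥-elim (x≢y refl)
  edgeWeight2-clones-apart x≢y at-u at-v = begin
    edgeWeight2 A u v + edgeWeight2 B u v
      ≡⟨ cong₂ _+_ (σ-merged x≢y (trans (redirect-u u≢v) (sym (redirect-v u≢v))))
                   (τ-merged x≢y (trans (redirect-v v≢u) (sym (redirect-u v≢u)))) ⟩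
    2 + 2
      ≡⟨ cong₂ _+_ edgeWeight2-uv edgeWeight2-vu ⟨
    edgeWeight2 w u v + edgeWeight2 w v u
      ≡⟨ cong (edgeWeight2 w u v +_) (cong₂ (edgeWeight2 w) (transpose-u u≢v) (transpose-v u≢v)) ⟨
    edgeWeight2 w u v + edgeWeight2 w (transpose u v u) (transpose u v v) ∎
    where open ≡-Reasoning
  edgeWeight2-clones-apart {y = y} x≢y at-u (elsewhere y≢u y≢v) = begin
    edgeWeight2 A u y + edgeWeight2 B u y
      ≡⟨ cong₂ _+_ (σ-apart x≢y (redirect-u u≢v) (redirect-elsewhere u≢v y≢u) (≢-sym y≢v))
                   (τ-apart x≢y (redirect-elsewhere v≢u u≢v) (redirect-elsewhere v≢u y≢v) x≢y) ⟩
    edgeWeight2 w v y + edgeWeight2 w u y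
      ≡⟨ +-comm (edgeWeight2 w v y) (edgeWeight2 w u y) ⟩
    edgeWeight2 w u y + edgeWeight2 w v y
      ≡⟨ cong (edgeWeight2 w u y +_) (cong₂ (edgeWeight2 w) (transpose-u u≢v) (transpose-elsewhere u≢v y≢u y≢v)) ⟨
    edgeWeight2 w u y + edgeWeight2 w (transpose u v u) (transpose u v y) ∎
    where open ≡-Reasoning
  edgeWeight2-clones-apart {y = y} x≢y at-v (elsewhere y≢u y≢v) = begin
    edgeWeight2 A v y + edgeWeight2 B v y
      ≡⟨ cong₂ _+_ (σ-apart x≢y (redirect-v u≢v) (redirect-elsewhere u≢v y≢u) x≢y)
                   (τ-apart x≢y (redirect-u v≢u) (redirect-elsewhere v≢u y≢v) (≢-sym y≢u)) ⟩
    edgeWeight2 w v y + edgeWeight2 w u y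
      ≡⟨ cong (edgeWeight2 w v y +_) (cong₂ (edgeWeight2 w) (transpose-v u≢v) (transpose-elsewhere u≢v y≢u y≢v)) ⟨
    edgeWeight2 w v y + edgeWeight2 w (transpose u v v) (transpose u v y) ∎
    where open ≡-Reasoning
  edgeWeight2-clones-apart x≢y at-v at-u = mirror {v} {u} (edgeWeight2-clones-apart (≢-sym x≢y) at-u at-v)
  edgeWeight2-clones-apart {x} x≢y p@(elsewhere _ _) at-u = mirror {x} {u} (edgeWeight2-clones-apart (≢-sym x≢y) at-u p)
  edgeWeight2-clones-apart {x} x≢y p@(elsewhere _ _) at-v = mirror {x} {v} (edgeWeight2-clones-apart (≢-sym x≢y) at-v p)
  edgeWeight2-clones-apart {x = x} {y} x≢y (elsewhere x≢u x≢v) (elsewhere y≢u y≢v) = cong₂ _+_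
    (σ-apart x≢y (redirect-elsewhere u≢v x≢u) (redirect-elsewhere u≢v y≢u) x≢y)
    (trans (τ-apart x≢y (redirect-elsewhere v≢u x≢v) (redirect-elsewhere v≢u y≢v) x≢y)
           (sym (cong₂ (edgeWeight2 w) (transpose-elsewhere u≢v x≢u x≢v) (transpose-elsewhere u≢v y≢u y≢v))))

  -- Together the two clones weigh each pair xy as w does on xy and on its image under the
  -- transposition of u and v; summing over all pairs the transposition disappears.
  edgeWeight2-clones : ∀ x y → edgeWeight2 A x y + edgeWeight2 B x y ≡
                               edgeWeight2 w x y + edgeWeight2 w (transpose u v x) (transpose u v y)
  edgeWeight2-clones x y = diagonal-or-apart (x ≟ y)
    where
    diagonal-or-apart : Dec (x ≡ y) →
      edgeWeight2 A x y + edgeWeight2 B x y ≡ edgeWeight2 w x y + edgeWeight2 w (transpose u v x) (transpose u v y)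
    diagonal-or-apart (yes refl) = cong₂ _+_ (trans (edgeWeight2-diag A x) (sym (edgeWeight2-diag w x)))
                                             (trans (edgeWeight2-diag B x) (sym (edgeWeight2-diag w _)))
    diagonal-or-apart (no x≢y) = edgeWeight2-clones-apart x≢y (position u v x) (position u v y)

  orderedWeight2-clones : orderedWeight2 A + orderedWeight2 B ≡ orderedWeight2 w + orderedWeight2 w
  orderedWeight2-clones = begin
    orderedWeight2 A + orderedWeight2 B
      ≡⟨ ∑∑-distrib-+ (edgeWeight2 A) (edgeWeight2 B) ⟨
    ∑[ x < k ] ∑[ y < k ] (edgeWeight2 A x y + edgeWeight2 B x y)
      ≡⟨ sum-cong-≗ (λ x → sum-cong-≗ (edgeWeight2-clones x)) ⟩
    ∑[ x < k ] ∑[ y < k ] (edgeWeight2 w x y + edgeWeight2 w (π x) (π y))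
      ≡⟨ ∑∑-distrib-+ (edgeWeight2 w) (λ x y → edgeWeight2 w (π x) (π y)) ⟩
    orderedWeight2 w + ∑[ x < k ] ∑[ y < k ] edgeWeight2 w (π x) (π y)
      ≡⟨ cong (orderedWeight2 w +_) (sum-cong-≗ λ x → ∑-permute (edgeWeight2 w (π x)) (Permutation.transpose u v)) ⟨
    orderedWeight2 w + ∑[ x < k ] ∑[ y < k ] edgeWeight2 w (π x) y
      ≡⟨ cong (orderedWeight2 w +_) (∑-permute (λ x → ∑[ y < k ] edgeWeight2 w x y) (Permutation.transpose u v)) ⟨
    orderedWeight2 w + orderedWeight2 w ∎
    where
    open ≡-Reasoning
    π = transpose u v

  weight2-clone-≤ : weight2 w ≤ weight2 B → weight2 A ≤ weight2 w
  weight2-clone-≤ w≤B = ≮⇒≥ λ w<A → <-irrefl refl (begin-strict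
    orderedWeight2 w + orderedWeight2 w
      ≡⟨ cong₂ _+_ (weight2-double w sym-w) (weight2-double w sym-w) ⟨
    (weight2 w + weight2 w) + (weight2 w + weight2 w)
      <⟨ +-mono-<-≤ (+-mono-< w<A w<A) (+-mono-≤ w≤B w≤B) ⟩
    (weight2 A + weight2 A) + (weight2 B + weight2 B)
      ≡⟨ cong₂ _+_ (weight2-double A (IsSymmetric-pullback _ w sym-w)) (weight2-double B (IsSymmetric-pullback _ w sym-w)) ⟩
    orderedWeight2 A + orderedWeight2 B
      ≡⟨ orderedWeight2-clones ⟩
    orderedWeight2 w + orderedWeight2 w ∎)
    where open ≤-Reasoning

IsMinimum-clone : ∀ {k ℋ} {w : Weighting k} {u v} → IsMinimum ℋ w → u ≢ v → w u v ≡ w1 →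
                  IsMinimum ℋ (clone u v w)
IsMinimum-clone {ℋ = ℋ} {w} {u} {v} (sym-w , free , least) u≢v uv≡w1 =
  IsSymmetric-pullback (redirect u v) w sym-w , Free-pullback (redirect u v) w ℋ free ,
  λ w′ sym′ free′ → ≤-trans clone-≤ (least w′ sym′ free′)
  where
  clone-≤ : weight2 (clone u v w) ≤ weight2 w
  clone-≤ = weight2-clone-≤ sym-w u≢v uv≡w1
    (least (clone v u w) (IsSymmetric-pullback (redirect v u) w sym-w) (Free-pullback (redirect v u) w ℋ free))

module _ {k : ℕ} (w : Weighting k) where

  Twins : Fin k → Fin k → Set
  Twins x y = ∀ z → z ≢ x → z ≢ y → w x z ≡ w y z

  TwinClosed : Set
  TwinClosed = ∀ x y → x ≢ y → w x y ≡ w1 → Twins x y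

  TwinClosedBelow : ℕ → Set
  TwinClosedBelow m = ∀ x y → toℕ x < m → toℕ y < m → x ≢ y → w x y ≡ w1 → Twins x y

  Twins-sym : ∀ {x y} → Twins x y → Twins y x
  Twins-sym twins z z≢y z≢x = sym (twins z z≢x z≢y)

  Twins-trans : IsSymmetric w → ∀ {x y z} → w x y ≡ w1 → w y z ≡ w1 → Twins x y → Twins y z → Twins x z
  Twins-trans sym-w {x} {y} {z} xy≡w1 yz≡w1 xy yz t t≢x t≢z with t ≟ y
  ... | yes refl = trans xy≡w1 (sym (trans (sym-w z t) yz≡w1))
  ... | no t≢y = trans (xy t t≢x t≢y) (yz t t≢y t≢z)

module _ {k : ℕ} (w : Weighting k) {u v : Fin k} (u≢v : u ≢ v) where

  private
    A : Weighting k
    A = clone u v w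

  clone-merged : clone u v w u v ≡ w1
  clone-merged = pullback-merged (redirect u v) w {u} {v} (trans (redirect-u u≢v) (sym (redirect-v u≢v)))

  clone-outside : ∀ {x y} → x ≢ u → y ≢ u → x ≢ y → clone u v w x y ≡ w x y
  clone-outside {x} {y} x≢u y≢u = pullback-apart (redirect u v) w {x} {y} (redirect-elsewhere u≢v x≢u) (redirect-elsewhere u≢v y≢u)

  clone-from-u : ∀ {y} → y ≢ u → y ≢ v → clone u v w u y ≡ w v y
  clone-from-u {y} y≢u y≢v = pullback-apart (redirect u v) w {u} {y} (redirect-u u≢v) (redirect-elsewhere u≢v y≢u) (≢-sym y≢v)

  Twins-clone : Twins (clone u v w) u v
  Twins-clone z z≢u z≢v = trans (clone-from-u z≢u z≢v) (sym (clone-outside (≢-sym u≢v) z≢u (≢-sym z≢v)))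

  -- Cloning u keeps every twin pair avoiding u: seen from such a pair, u now looks like v.
  Twins-clone-outside : IsSymmetric w → ∀ {x y} → x ≢ u → y ≢ u → x ≢ y → w x y ≡ w1 →
                        Twins w x y → Twins (clone u v w) x y
  Twins-clone-outside sym-w {x} {y} x≢u y≢u x≢y xy≡w1 twins z z≢x z≢y = at-u-or-elsewhere (z ≟ u)
    where
    sym-A = IsSymmetric-pullback (redirect u v) w sym-w
    u-row-v : ∀ {y} → y ≢ u → y ≢ v → w v y ≡ w1 → A u v ≡ A u y
    u-row-v y≢u y≢v vy≡w1 = trans clone-merged (sym (trans (clone-from-u y≢u y≢v) vy≡w1))
    u-row : ∀ {x y} → x ≢ u → y ≢ u → x ≢ y → w x y ≡ w1 → Twins w x y → A u x ≡ A u y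
    u-row {x} {y} x≢u y≢u x≢y xy≡w1 twins with x ≟ v | y ≟ v
    ... | yes refl | _ = u-row-v y≢u (≢-sym x≢y) xy≡w1
    ... | no _ | yes refl = sym (u-row-v x≢u x≢y (trans (sym-w y x) xy≡w1))
    ... | no x≢v | no y≢v = trans (clone-from-u x≢u x≢v)
        (trans (trans (sym-w v x) (twins v (≢-sym x≢v) (≢-sym y≢v))) (trans (sym-w y v) (sym (clone-from-u y≢u y≢v))))
    at-u-or-elsewhere : Dec (z ≡ u) → A x z ≡ A y z
    at-u-or-elsewhere (no z≢u) =
      trans (clone-outside x≢u z≢u (≢-sym z≢x)) (trans (twins z z≢x z≢y) (sym (clone-outside y≢u z≢u (≢-sym z≢y))))
    at-u-or-elsewhere (yes refl) = trans (sym-A x z) (trans (u-row x≢u y≢u x≢y xy≡w1 twins) (sym-A z y))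

module _ {k : ℕ} {m : ℕ} (m<k : m < k) where

  private
    u : Fin k
    u = fromℕ< m<k

    below⇒≢u : ∀ {x} → toℕ x < m → x ≢ u
    below⇒≢u x<m refl = <-irrefl (Finₚ.toℕ-fromℕ< m<k) x<m

    below-suc : ∀ {x} → toℕ x < suc m → toℕ x < m ⊎ x ≡ u
    below-suc x<1+m with m≤n⇒m<n∨m≡n (s≤s⁻¹ x<1+m)
    ... | inj₁ x<m = inj₁ x<m
    ... | inj₂ x≡m = inj₂ (Finₚ.toℕ-injective (trans x≡m (sym (Finₚ.toℕ-fromℕ< m<k))))

  TwinClosedBelow-suc : ∀ {w : Weighting k} → IsSymmetric w → TwinClosedBelow w m →
    (∀ y → toℕ y < m → w u y ≡ w1 → Twins w u y) → TwinClosedBelow w (suc m)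
  TwinClosedBelow-suc {w} sym-w closed u-closed x y x<1+m y<1+m x≢y xy≡w1 with below-suc x<1+m | below-suc y<1+m
  ... | inj₁ x<m | inj₁ y<m = closed x y x<m y<m x≢y xy≡w1
  ... | inj₂ refl | inj₁ y<m = u-closed y y<m xy≡w1
  ... | inj₁ x<m | inj₂ refl = Twins-sym w (u-closed x x<m (trans (sym-w u x) xy≡w1))
  ... | inj₂ refl | inj₂ refl = ⊥-elim (x≢y refl)

  TwinClosedBelow-clone : ∀ {w : Weighting k} {v} → IsSymmetric w → TwinClosedBelow w m →
    toℕ v < m → w u v ≡ w1 → TwinClosedBelow (clone u v w) (suc m)
  TwinClosedBelow-clone {w} {v} sym-w closed v<m uv≡w1 =
    TwinClosedBelow-suc (IsSymmetric-pullback (redirect u v) w sym-w) closed-A u-closed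
    where
    u≢v : u ≢ v
    u≢v = ≢-sym (below⇒≢u v<m)
    A = clone u v w
    closed-A : TwinClosedBelow A m
    closed-A x y x<m y<m x≢y Axy≡w1 = Twins-clone-outside w u≢v sym-w (below⇒≢u x<m) (below⇒≢u y<m) x≢y xy≡w1
      (closed x y x<m y<m x≢y xy≡w1)
      where xy≡w1 = trans (sym (clone-outside w u≢v (below⇒≢u x<m) (below⇒≢u y<m) x≢y)) Axy≡w1
    -- A weight-1 neighbour y ≢ v of u in the clone is one of v, hence a twin of v and so of u.
    u-closed : ∀ y → toℕ y < m → A u y ≡ w1 → Twins A u y
    u-closed y y<m uy≡w1 with y ≟ v
    ... | yes refl = Twins-clone w u≢v
    ... | no y≢v = Twins-trans A (IsSymmetric-pullback (redirect u v) w sym-w) (clone-merged w u≢v) vy≡w1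
      (Twins-clone w u≢v) (closed-A v y v<m y<m (≢-sym y≢v) vy≡w1)
      where vy≡w1 = trans (clone-outside w u≢v (below⇒≢u v<m) (below⇒≢u y<m) (≢-sym y≢v))
                          (trans (sym (clone-from-u w u≢v (below⇒≢u y<m) y≢v)) uy≡w1)

  TwinClosedBelow-minimum-suc : ∀ {ℋ} {w : Weighting k} → IsMinimum ℋ w → TwinClosedBelow w m →
                                ∃ λ w′ → IsMinimum ℋ w′ × TwinClosedBelow w′ (suc m)
  TwinClosedBelow-minimum-suc {w = w} minimum@(sym-w , _) closed
    with Finₚ.any? (λ v → (toℕ v <? m) ×-dec (w u v ≟ᵂ w1))
  ... | yes (v , v<m , uv≡w1) =
    clone u v w , IsMinimum-clone minimum (≢-sym (below⇒≢u v<m)) uv≡w1 , TwinClosedBelow-clone sym-w closed v<m uv≡w1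
  ... | no no-partner =
    w , minimum , TwinClosedBelow-suc sym-w closed (λ y y<m uy≡w1 → ⊥-elim (no-partner (y , y<m , uy≡w1)))

Quotient : ∀ {k} → (Fin k → Fin k → Set) → Set
Quotient {k} _∼_ = Σ ℕ λ s → Σ (Fin k → Fin s) λ p →
  Surjective _≡_ _≡_ p × (∀ {x y} → p x ≡ p y → x ∼ y) × (∀ {x y} → x ∼ y → p x ≡ p y)

module _ {k : ℕ} {_∼_ : Fin (suc k) → Fin (suc k) → Set} (eq : IsDecEquivalence _∼_) where

  open IsDecEquivalence eq using () renaming (refl to ∼-refl; sym to ∼-sym; trans to ∼-trans)

  Quotient-join : ∀ {j} → Fin.zero ∼ Fin.suc j → Quotient (λ x y → Fin.suc x ∼ Fin.suc y) → Quotient _∼_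
  Quotient-join {j} 0∼j (s , p , surj , sound , complete) = s , p′ , surj′ , sound′ , complete′
    where
    p′ : Fin (suc k) → Fin s
    p′ Fin.zero = p j
    p′ (Fin.suc x) = p x
    surj′ : Surjective _≡_ _≡_ p′
    surj′ c with surj c
    ... | x , px≡c = Fin.suc x , λ { refl → px≡c refl }
    sound′ : ∀ {x y} → p′ x ≡ p′ y → x ∼ y
    sound′ {Fin.zero} {Fin.zero} _ = ∼-refl
    sound′ {Fin.zero} {Fin.suc y} pj≡py = ∼-trans 0∼j (sound pj≡py)
    sound′ {Fin.suc x} {Fin.zero} px≡pj = ∼-trans (sound px≡pj) (∼-sym 0∼j)
    sound′ {Fin.suc x} {Fin.suc y} px≡py = sound px≡py
    complete′ : ∀ {x y} → x ∼ y → p′ x ≡ p′ y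
    complete′ {Fin.zero} {Fin.zero} _ = refl
    complete′ {Fin.zero} {Fin.suc y} 0∼y = complete (∼-trans (∼-sym 0∼j) 0∼y)
    complete′ {Fin.suc x} {Fin.zero} x∼0 = complete (∼-trans x∼0 0∼j)
    complete′ {Fin.suc x} {Fin.suc y} x∼y = complete x∼y

  Quotient-new : (∀ j → ¬ Fin.zero ∼ Fin.suc j) → Quotient (λ x y → Fin.suc x ∼ Fin.suc y) → Quotient _∼_
  Quotient-new isolated (s , p , surj , sound , complete) = suc s , p′ , surj′ , sound′ , complete′
    where
    p′ : Fin (suc k) → Fin (suc s)
    p′ Fin.zero = Fin.zero
    p′ (Fin.suc x) = Fin.suc (p x)
    surj′ : Surjective _≡_ _≡_ p′
    surj′ Fin.zero = Fin.zero , λ { refl → refl }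
    surj′ (Fin.suc c) with surj c
    ... | x , px≡c = Fin.suc x , λ { refl → cong Fin.suc (px≡c refl) }
    sound′ : ∀ {x y} → p′ x ≡ p′ y → x ∼ y
    sound′ {Fin.zero} {Fin.zero} _ = ∼-refl
    sound′ {Fin.suc x} {Fin.suc y} px≡py = sound (Finₚ.suc-injective px≡py)
    complete′ : ∀ {x y} → x ∼ y → p′ x ≡ p′ y
    complete′ {Fin.zero} {Fin.zero} _ = refl
    complete′ {Fin.zero} {Fin.suc y} 0∼y = ⊥-elim (isolated y 0∼y)
    complete′ {Fin.suc x} {Fin.zero} x∼0 = ⊥-elim (isolated x (∼-sym x∼0))
    complete′ {Fin.suc x} {Fin.suc y} x∼y = cong Fin.suc (complete x∼y)

quotient : ∀ {k} {_∼_ : Fin k → Fin k → Set} → IsDecEquivalence _∼_ → Quotient _∼_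
quotient {zero} _ = 0 , (λ ()) , (λ ()) , (λ { {()} }) , (λ { {()} })
quotient {suc k} eq with Finₚ.any? (λ j → IsDecEquivalence._≟_ eq Fin.zero (Fin.suc j))
... | yes (j , 0∼j) = Quotient-join eq 0∼j (quotient (On.isDecEquivalence Fin.suc eq))
... | no isolated = Quotient-new eq (λ j 0∼j → isolated (j , 0∼j)) (quotient (On.isDecEquivalence Fin.suc eq))

module _ {k : ℕ} {w : Weighting k} (sym-w : IsSymmetric w) (closed : TwinClosed w) where

  _∼_ : Fin k → Fin k → Set
  x ∼ y = x ≡ y ⊎ w x y ≡ w1

  ∼-isDecEquivalence : IsDecEquivalence _∼_
  ∼-isDecEquivalence = record
    { isEquivalence = record
      { refl = inj₁ refl
      ; sym = λ { (inj₁ refl) → inj₁ refl ; (inj₂ xy≡w1) → inj₂ (trans (sym-w _ _) xy≡w1) }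
      ; trans = ∼-trans }
    ; _≟_ = _∼?_ }
    where
    ∼-trans : ∀ {x y z} → x ∼ y → y ∼ z → x ∼ z
    ∼-trans (inj₁ refl) y∼z = y∼z
    ∼-trans (inj₂ xy≡w1) (inj₁ refl) = inj₂ xy≡w1
    ∼-trans {x} {y} {z} (inj₂ xy≡w1) (inj₂ yz≡w1) with x ≟ y | z ≟ y | x ≟ z
    ... | yes refl | _ | _ = inj₂ yz≡w1
    ... | no _ | yes refl | _ = inj₂ xy≡w1
    ... | no _ | no _ | yes x≡z = inj₁ x≡z
    ... | no x≢y | no z≢y | no x≢z = inj₂ (trans (closed x y x≢y xy≡w1 z (≢-sym x≢z) z≢y) yz≡w1)
    _∼?_ : ∀ x y → Dec (x ∼ y)
    x ∼? y = (x ≟ y) ⊎-dec (w x y ≟ᵂ w1)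

  ∼-transfer : ∀ {x x′ y} → ¬ x ∼ y → x ∼ x′ → w x y ≡ w x′ y
  ∼-transfer ¬x∼y (inj₁ refl) = refl
  ∼-transfer {x} {x′} {y} ¬x∼y (inj₂ xx′≡w1) with x ≟ x′ | y ≟ x′
  ... | yes refl | _ = refl
  ... | no _ | yes refl = ⊥-elim (¬x∼y (inj₂ xx′≡w1))
  ... | no x≢x′ | no y≢x′ = closed x x′ x≢x′ xx′≡w1 y (λ y≡x → ¬x∼y (inj₁ (sym y≡x))) y≢x′

  ∼-transfer₂ : ∀ {x x′ y y′} → ¬ x ∼ y → x ∼ x′ → y ∼ y′ → w x y ≡ w x′ y′
  ∼-transfer₂ {x} {x′} {y} {y′} ¬x∼y x∼x′ y∼y′ = begin
    w x y     ≡⟨ ∼-transfer ¬x∼y x∼x′ ⟩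
    w x′ y    ≡⟨ sym-w x′ y ⟩
    w y x′    ≡⟨ ∼-transfer (¬x∼y ∘ ∼-trans x∼x′ ∘ ∼-sym) y∼y′ ⟩
    w y′ x′   ≡⟨ sym-w y′ x′ ⟩
    w x′ y′   ∎
    where
    open ≡-Reasoning
    open IsDecEquivalence ∼-isDecEquivalence renaming (sym to ∼-sym; trans to ∼-trans)

  structured : Structured w
  structured with quotient ∼-isDecEquivalence
  ... | s , p , surj , sound , complete = s , p , surj , inside , between
    where
    inside : ∀ u v → u ≢ v → p u ≡ p v → w u v ≡ w1
    inside u v u≢v pu≡pv with sound pu≡pv
    ... | inj₁ u≡v = ⊥-elim (u≢v u≡v)
    ... | inj₂ uv≡w1 = uv≡w1
    between : ∀ (i j : Fin s) → i <ᶠ j →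
      (∀ u v → p u ≡ i → p v ≡ j → w u v ≡ w½) ⊎ (∀ u v → p u ≡ i → p v ≡ j → w u v ≡ w0)
    between i j i<j with surj i | surj j
    ... | u₀ , pu₀ | v₀ , pv₀ = by-weight (w u₀ v₀) refl
      where
      apart : ∀ {u v} → p u ≡ i → p v ≡ j → ¬ u ∼ v
      apart pu≡i pv≡j u∼v = Finₚ.<-irrefl (trans (sym pu≡i) (trans (complete u∼v) pv≡j)) i<j
      ¬u₀∼v₀ : ¬ u₀ ∼ v₀
      ¬u₀∼v₀ = apart (pu₀ refl) (pv₀ refl)
      constant : ∀ u v → p u ≡ i → p v ≡ j → w u v ≡ w u₀ v₀
      constant u v pu≡i pv≡j =
        ∼-transfer₂ (apart pu≡i pv≡j) (sound (trans pu≡i (sym (pu₀ refl)))) (sound (trans pv≡j (sym (pv₀ refl))))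
      by-weight : ∀ c → w u₀ v₀ ≡ c →
        (∀ u v → p u ≡ i → p v ≡ j → w u v ≡ w½) ⊎ (∀ u v → p u ≡ i → p v ≡ j → w u v ≡ w0)
      by-weight w0 u₀v₀≡w0 = inj₂ λ u v pu≡i pv≡j → trans (constant u v pu≡i pv≡j) u₀v₀≡w0
      by-weight w½ u₀v₀≡w½ = inj₁ λ u v pu≡i pv≡j → trans (constant u v pu≡i pv≡j) u₀v₀≡w½
      by-weight w1 u₀v₀≡w1 = ⊥-elim (¬u₀∼v₀ (inj₂ u₀v₀≡w1))

minimum-TwinClosedBelow : ∀ {k} (ℋ : List Graph) {w₀ : Weighting k} → IsSymmetric w₀ → Free ℋ w₀ →
                          ∀ m → m ≤ k → ∃ λ w → IsMinimum ℋ w × TwinClosedBelow w m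
minimum-TwinClosedBelow ℋ sym₀ free₀ zero _ with minimum-exists ℋ sym₀ free₀
... | w , minimum = w , minimum , λ _ _ ()
minimum-TwinClosedBelow ℋ sym₀ free₀ (suc m) m<k with minimum-TwinClosedBelow ℋ sym₀ free₀ m (<⇒≤ m<k)
... | w , minimum , closed = TwinClosedBelow-minimum-suc m<k minimum closed

proposition12 : (k : ℕ) → 0 < k → (ℋ : List Graph) →
    (w₀ : Weighting k) → IsSymmetric w₀ → Free ℋ w₀ →
    Σ (Weighting k) λ w → IsSymmetric w × Free ℋ w ×
      ((w′ : Weighting k) → IsSymmetric w′ → Free ℋ w′ → weight2 w ≤ weight2 w′) ×
      Structured w
proposition12 k _ ℋ w₀ sym₀ free₀ with minimum-TwinClosedBelow ℋ sym₀ free₀ k ≤-refl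
... | w , (sym-w , free , least) , closed =
  w , sym-w , free , least , structured sym-w (λ x y → closed x y (Finₚ.toℕ<n x) (Finₚ.toℕ<n y))
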